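{- Let $R$ be a region with $n$ cells, $n$ a multiple of $3$, let $P\subseteq R$ be a set of $k=n/3$ peg cells, and let $G$ be the region network of $(R,P)$. If $(R,P)$ has a p-cover, then the value of a maximum flow in $G$ equals $n/3$.
   Context: A cell is a unit square $[x,x+1]\times[y,y+1]$, $x,y\in\mathbb Z$; it lies in row $y$. A region is a finite union of cells with connected interior; two cells are adjacent if their Manhattan distance is $1$. A tromino is an L-shaped set of three cells: a corner cell plus two tips adjacent to it, one horizontally and one vertically. A p-cover of $(R,P)$ is a set of pairwise non-overlapping trominoes contained in $R$ covering all cells of $R$, each with its corner cell in $P$ and its tips outside $P$. Region network: color a cell black if its row is even and white if odd; let $B$ be the black cells not in $P$ and $W$ the white cells not in $P$. $G$ has a vertex for each cell of $R$ plus a source $s$ and sink $t$; directed edges $s\to b$ for each $b\in B$; $w\to t$ for each $w\in W$; $b\to p$ for $b\in B$, $p\in P$ adjacent in $R$; $p\to w$ for $p\in P$, $w\in W$ adjacent in $R$. All edges have capacity $1$; every cell vertex has vertex capacity $1$, and $s,t$ have infinite capacity. A flow is a function $f:E(G)\to\mathbb N$ respecting edge capacities, with total flow entering each vertex at most its vertex capacity, and with flow conservation at every vertex other than $s,t$; its value is $|f|=\sum_v f(s,v)$. -}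

module Defs where

open import Data.Nat as ℕ using (ℕ; _≤_)
open import Data.Integer as ℤ using (ℤ; +_; -[1+_]; ∣_∣; _-_)
open import Data.Integer.Divisibility using (_∣_)
open import Data.Product using (_×_; _,_; proj₁; proj₂; ∃; ∃-syntax)
open import Data.List using (List; []; _∷_; map; length)
open import Data.Nat.ListAction using (sum)
open import Data.List.Membership.Propositional using (_∈_; _∉_)
open import Data.List.Relation.Unary.All using (All)
open import Data.List.Relation.Unary.Unique.Propositional using (Unique)
open import Data.List.Relation.Unary.AllPairs using (AllPairs)
open import Relation.Binary.PropositionalEquality using (_≡_)
open import Relation.Nullary using (¬_)

-- Cells: the cell [x,x+1]×[y,y+1] is represented by (x , y); its row is y.

Cell : Set
Cell = ℤ × ℤ

row : Cell → ℤ
row = proj₂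

Adjacent : Cell → Cell → Set
Adjacent (x , y) (x' , y') = ∣ x - x' ∣ ℕ.+ ∣ y - y' ∣ ≡ 1

-- A finite set of cells is given as a duplicate-free list.
-- Path within R (via adjacent cells of R)
data PathIn (R : List Cell) : Cell → Cell → Set where
  here : ∀ {c} → c ∈ R → PathIn R c c
  step : ∀ {c d e} → c ∈ R → Adjacent c d → PathIn R d e → PathIn R c e

-- A region: finite union of cells with connected interior, i.e. a finite
-- set of cells connected under edge-adjacency.
record IsRegion (R : List Cell) : Set where
  field
    distinct  : Unique R
    connected : ∀ {c d} → c ∈ R → d ∈ R → PathIn R c d

data Sign : Set where
  plus minus : Sign

shift : Sign → ℤ → ℤ
shift plus  z = z ℤ.+ + 1
shift minus z = z ℤ.+ -[1+ 0 ]

record Tromino : Set where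
  constructor tromino
  field
    corner : Cell
    hdir   : Sign
    vdir   : Sign

  hTip : Cell
  hTip = shift hdir (proj₁ corner) , proj₂ corner

  vTip : Cell
  vTip = proj₁ corner , shift vdir (proj₂ corner)

  cells : List Cell
  cells = corner ∷ hTip ∷ vTip ∷ []

open Tromino public

DisjointT : Tromino → Tromino → Set
DisjointT t u = ∀ {c} → c ∈ cells t → c ∉ cells u

record PCover (R P : List Cell) (T : List Tromino) : Set where
  field
    nonOverlapping : AllPairs DisjointT T
    contained      : All (λ t → All (_∈ R) (cells t)) T
    covers         : ∀ {c} → c ∈ R → ∃[ t ] (t ∈ T × c ∈ cells t)
    cornerPeg      : All (λ t → corner t ∈ P) T
    hTipFree       : All (λ t → hTip t ∉ P) T
    vTipFree       : All (λ t → vTip t ∉ P) T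

HasPCover : List Cell → List Cell → Set
HasPCover R P = ∃[ T ] PCover R P T

Black : Cell → Set
Black c = (+ 2) ∣ row c

White : Cell → Set
White c = ¬ Black c

data Vertex : Set where
  src  : Vertex
  snk  : Vertex
  cell : Cell → Vertex

module Network (R P : List Cell) where

  InB : Cell → Set
  InB c = c ∈ R × c ∉ P × Black c

  InW : Cell → Set
  InW c = c ∈ R × c ∉ P × White c

  data Edge : Vertex → Vertex → Set where
    s→b : ∀ {b} → InB b → Edge src (cell b)
    w→t : ∀ {w} → InW w → Edge (cell w) snk
    b→p : ∀ {b p} → InB b → p ∈ P → Adjacent b p → Edge (cell b) (cell p)
    p→w : ∀ {p w} → p ∈ P → InW w → Adjacent p w → Edge (cell p) (cell w)

  vertices : List Vertex
  vertices = src ∷ snk ∷ map cell R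

  inflow : (Vertex → Vertex → ℕ) → Vertex → ℕ
  inflow f v = sum (map (λ u → f u v) vertices)

  outflow : (Vertex → Vertex → ℕ) → Vertex → ℕ
  outflow f v = sum (map (λ u → f v u) vertices)

  record IsFlow (f : Vertex → Vertex → ℕ) : Set where
    field
      offEdges     : ∀ u v → ¬ Edge u v → f u v ≡ 0
      edgeCap      : ∀ u v → f u v ≤ 1
      vertexCap    : ∀ {c} → c ∈ R → inflow f (cell c) ≤ 1
      conservation : ∀ {c} → c ∈ R → inflow f (cell c) ≡ outflow f (cell c)

  value : (Vertex → Vertex → ℕ) → ℕ
  value f = outflow f src

  MaxFlowValue : ℕ → Set
  MaxFlowValue m = (∃[ f ] (IsFlow f × value f ≡ m))
                 × (∀ f → IsFlow f → value f ≤ m)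

module Submission where

-- Write ⟦ c ∈? P ⟧ for the 0/1 indicator of P.  Every flow f of the network
-- is routed through the pegs:
--
--     value f  =  ∑[ c ∈ R ] ⟦ c ∈? P ⟧ * inflow f c        (value-through-pegs)
--
-- since s only feeds the black non-peg cells, these forward their inflow
-- (conservation) only to pegs, and pegs receive only from such cells.  With
-- the vertex capacities this bounds every flow by |P| = k.  Conversely a
-- p-cover T yields a flow: each tromino carries one unit along the route
-- s → black tip → corner → white tip → t (its two tips lie in rows of
-- opposite parity).  As the trominoes partition R, every cell lies on exactly
-- one route and has in- and outflow 1, so the identity evaluates to |P| = k.

open import Defs
open import Data.Nat using (ℕ; _*_)
open import Data.List using (List; length)
open import Data.List.Membership.Propositional using (_∈_)
open import Data.List.Relation.Unary.All using (All)
open import Data.List.Relation.Unary.Unique.Propositional using (Unique)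
open import Relation.Binary.PropositionalEquality using (_≡_)

open import Data.Nat.Properties as Nat using (+-comm; *-identityˡ; *-identityʳ; *-zeroʳ; ≤-trans; ≤-reflexive)
open import Algebra.Properties.CommutativeSemigroup Nat.+-commutativeSemigroup using (interchange)
open import Data.Empty using (⊥-elim)
open import Data.Integer as ℤ using (-[1+_]; ∣_∣)
open import Data.Integer.Properties using (∣i-j∣≡∣j-i∣; +-inverseʳ)
open import Data.Integer.Tactic.RingSolver using (solve-∀)
open import Data.List using ([]; _∷_; map)
open import Data.List.Membership.Propositional using (_∉_; find; lose)
open import Data.List.Membership.Propositional.Properties using (∈-map⁺)
open import Data.List.Relation.Unary.All.Properties using () renaming (map⁺ to All-map⁺)
open import Data.List.Relation.Unary.Any using (here; there; any?)
open import Data.List.Relation.Unary.AllPairs using (AllPairs; []; _∷_)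
open import Data.List.Relation.Unary.Unique.Propositional.Properties using () renaming (map⁺ to Unique-map⁺)
open import Data.Nat using (suc; _+_; _≤_; z≤n; s≤s)
open import Data.Nat.Divisibility using (_∣_; _∣?_; _∣0; n∣n; ∣1⇒≡1; ∣m∣n⇒∣m+n; ∣m+n∣m⇒∣n)
open import Data.Nat.ListAction using (sum)
open import Data.Product using (_×_; _,_; proj₁; proj₂; ∃-syntax; ∃₂)
open import Data.Product.Properties using (≡-dec)
open import Data.Sum using (_⊎_; inj₁; inj₂)
open import Function using (_∘_)
open import Relation.Binary.Definitions using (DecidableEquality)
open import Relation.Binary.PropositionalEquality using (refl; sym; trans; cong; cong₂; subst; _≢_; module ≡-Reasoning)
open import Relation.Nullary using (¬_; Dec; yes; no; ¬?)
open import Relation.Nullary.Decidable using (_×-dec_; decidable-stable)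
import Data.List.Membership.DecPropositional as DecMembership
import Data.List.Relation.Unary.All as All

open ≡-Reasoning

sumOver : {A : Set} → List A → (A → ℕ) → ℕ
sumOver L g = sum (map g L)

infix 5 sumOver
syntax sumOver L (λ x → e) = ∑[ x ∈ L ] e

∑-cong : {A : Set} (L : List A) {g h : A → ℕ}
       → (∀ {x} → x ∈ L → g x ≡ h x) → sumOver L g ≡ sumOver L h
∑-cong []      g≡h = refl
∑-cong (x ∷ L) g≡h = cong₂ _+_ (g≡h (here refl)) (∑-cong L (g≡h ∘ there))

∑-zero : {A : Set} (L : List A) {g : A → ℕ} → (∀ {x} → x ∈ L → g x ≡ 0) → sumOver L g ≡ 0
∑-zero []      g≡0 = refl
∑-zero (x ∷ L) g≡0 = cong₂ _+_ (g≡0 (here refl)) (∑-zero L (g≡0 ∘ there))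

∑-+ : {A : Set} (L : List A) (g h : A → ℕ)
    → ∑[ x ∈ L ] (g x + h x) ≡ sumOver L g + sumOver L h
∑-+ []      g h = refl
∑-+ (x ∷ L) g h = trans (cong (g x + h x +_) (∑-+ L g h))
                        (interchange (g x) (h x) (sumOver L g) (sumOver L h))

∑-swap : {A B : Set} (L : List A) (M : List B) (g : A → B → ℕ)
       → ∑[ x ∈ L ] ∑[ y ∈ M ] g x y ≡ ∑[ y ∈ M ] ∑[ x ∈ L ] g x y
∑-swap []      M g = sym (∑-zero M (λ _ → refl))
∑-swap (x ∷ L) M g = trans (cong (sumOver M (g x) +_) (∑-swap L M g))
                           (sym (∑-+ M (g x) (λ y → ∑[ x' ∈ L ] g x' y)))

∑-mono : {A : Set} (L : List A) {g h : A → ℕ}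
       → (∀ {x} → x ∈ L → g x ≤ h x) → sumOver L g ≤ sumOver L h
∑-mono []      g≤h = z≤n
∑-mono (x ∷ L) g≤h = Nat.+-mono-≤ (g≤h (here refl)) (∑-mono L (g≤h ∘ there))

∑-map : {A B : Set} (k : A → B) (L : List A) (g : B → ℕ) → sumOver (map k L) g ≡ sumOver L (g ∘ k)
∑-map k []      g = refl
∑-map k (x ∷ L) g = cong (g (k x) +_) (∑-map k L g)

∑-single : {A : Set} (L : List A) {g : A → ℕ} {x : A} → Unique L → x ∈ L
         → (∀ {y} → y ∈ L → y ≢ x → g y ≡ 0) → sumOver L g ≡ g x
∑-single (y ∷ L) {g} (y∉L ∷ _) (here refl) off =
  trans (cong (g y +_) (∑-zero L (λ z∈L → off (there z∈L) (λ z≡y → All.lookup y∉L z∈L (sym z≡y)))))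
        (Nat.+-identityʳ (g y))
∑-single (y ∷ L) (y∉L ∷ uL) (there x∈L) off =
  cong₂ _+_ (off (here refl) (All.lookup y∉L x∈L)) (∑-single L uL x∈L (off ∘ there))

⟦_⟧ : {A : Set} → Dec A → ℕ
⟦ yes _ ⟧ = 1
⟦ no _ ⟧  = 0

⟦⟧-yes : {A : Set} (d : Dec A) → A → ⟦ d ⟧ ≡ 1
⟦⟧-yes (yes _) _ = refl
⟦⟧-yes (no ¬a) a = ⊥-elim (¬a a)

⟦⟧-no : {A : Set} (d : Dec A) → ¬ A → ⟦ d ⟧ ≡ 0
⟦⟧-no (yes a) ¬a = ⊥-elim (¬a a)
⟦⟧-no (no _)  _  = refl

⟦⟧≤1 : {A : Set} (d : Dec A) → ⟦ d ⟧ ≤ 1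
⟦⟧≤1 (yes _) = s≤s z≤n
⟦⟧≤1 (no _)  = z≤n

module Counting {A : Set} (_≟_ : DecidableEquality A) where
  open DecMembership _≟_ using (_∈?_)

  ⟦∈∷⟧ : ∀ {q Q} → q ∉ Q → ∀ x → ⟦ x ∈? (q ∷ Q) ⟧ ≡ ⟦ x ≟ q ⟧ + ⟦ x ∈? Q ⟧
  ⟦∈∷⟧ {q} {Q} q∉Q x with x ≟ q | x ∈? Q
  ... | yes refl | yes x∈Q = ⊥-elim (q∉Q x∈Q)
  ... | yes refl | no _    = refl
  ... | no _     | yes _   = refl
  ... | no _     | no _    = refl

  count-members : ∀ {R} (Q : List A) → Unique R → Unique Q → All (_∈ R) Q
                → ∑[ x ∈ R ] ⟦ x ∈? Q ⟧ ≡ length Q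
  count-members {R} [] _ _ _ = ∑-zero R (λ _ → refl)
  count-members {R} (q ∷ Q) uR (q∉Q ∷ uQ) (q∈R All.∷ Q⊆R) = begin
    ∑[ x ∈ R ] ⟦ x ∈? (q ∷ Q) ⟧            ≡⟨ ∑-cong R (λ {x} _ → ⟦∈∷⟧ (λ q∈Q → All.lookup q∉Q q∈Q refl) x) ⟩
    ∑[ x ∈ R ] (⟦ x ≟ q ⟧ + ⟦ x ∈? Q ⟧)    ≡⟨ ∑-+ R (λ x → ⟦ x ≟ q ⟧) (λ x → ⟦ x ∈? Q ⟧) ⟩
    (∑[ x ∈ R ] ⟦ x ≟ q ⟧) + (∑[ x ∈ R ] ⟦ x ∈? Q ⟧)
      ≡⟨ cong₂ _+_ (∑-single R uR q∈R (λ {x} _ x≢q → ⟦⟧-no (x ≟ q) x≢q)) (count-members Q uR uQ Q⊆R) ⟩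
    ⟦ q ≟ q ⟧ + length Q                   ≡⟨ cong (_+ length Q) (⟦⟧-yes (q ≟ q) refl) ⟩
    suc (length Q)                         ∎

_≟C_ : DecidableEquality Cell
_≟C_ = ≡-dec ℤ._≟_ ℤ._≟_

open DecMembership _≟C_ using (_∈?_)
open Counting _≟C_ using (count-members)

Even : ℕ → Set
Even n = 2 ∣ n

OppositeParity : ℕ → ℕ → Set
OppositeParity m n = (Even m → ¬ Even n) × (¬ Even m → Even n)

parity : ∀ n → Even n ⊎ Even (suc n)
parity 0       = inj₁ (2 ∣0)
parity (suc n) with parity n
... | inj₁ n-even  = inj₂ (∣m∣n⇒∣m+n (n∣n {2}) n-even)
... | inj₂ sn-even = inj₁ sn-even

even⇒odd-suc : ∀ {n} → Even n → ¬ Even (suc n)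
even⇒odd-suc {n} n-even sn-even
  with ∣1⇒≡1 (∣m+n∣m⇒∣n (subst Even (+-comm 1 n) sn-even) n-even)
... | ()

odd⇒even-suc : ∀ {n} → ¬ Even n → Even (suc n)
odd⇒even-suc {n} n-odd with parity n
... | inj₁ n-even  = ⊥-elim (n-odd n-even)
... | inj₂ sn-even = sn-even

suc-opposite : ∀ n → OppositeParity n (suc n)
suc-opposite n = even⇒odd-suc , odd⇒even-suc

opposite-sym : ∀ {m n} → OppositeParity m n → OppositeParity n m
opposite-sym {m} (even⇒odd , odd⇒even) =
  (λ n-even m-even → even⇒odd m-even n-even) ,
  (λ n-odd → decidable-stable (2 ∣? m) (λ m-odd → n-odd (odd⇒even m-odd)))

shift-abs : ∀ s y → ∣ shift s y ∣ ≡ suc ∣ y ∣ ⊎ suc ∣ shift s y ∣ ≡ ∣ y ∣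
shift-abs plus  (ℤ.+ n)         = inj₁ (+-comm n 1)
shift-abs plus  -[1+ 0 ]        = inj₂ refl
shift-abs plus  -[1+ suc n ]    = inj₂ refl
shift-abs minus (ℤ.+ 0)         = inj₁ refl
shift-abs minus (ℤ.+ suc n)     = inj₂ refl
shift-abs minus -[1+ n ]        = inj₁ (cong (suc ∘ suc) (Nat.+-identityʳ n))

shift-opposite : ∀ s y → OppositeParity ∣ y ∣ ∣ shift s y ∣
shift-opposite s y with shift-abs s y
... | inj₁ up   = subst (OppositeParity ∣ y ∣) (sym up) (suc-opposite ∣ y ∣)
... | inj₂ down = subst (λ n → OppositeParity n ∣ shift s y ∣) down (opposite-sym (suc-opposite _))

black? : (c : Cell) → Dec (Black c)
black? c = 2 ∣? ∣ row c ∣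

vTip-colour : ∀ t → OppositeParity ∣ row (corner t) ∣ ∣ row (vTip t) ∣
vTip-colour t = shift-opposite (vdir t) (row (corner t))

adjacent-sym : ∀ c d → Adjacent c d → Adjacent d c
adjacent-sym (x , y) (x' , y') c~d = trans (cong₂ _+_ (∣i-j∣≡∣j-i∣ x' x) (∣i-j∣≡∣j-i∣ y' y)) c~d

added-back : ∀ z d → (z ℤ.+ d) ℤ.- z ≡ d
added-back = solve-∀

shift-distance : ∀ s z → ∣ shift s z ℤ.- z ∣ ≡ 1
shift-distance plus  z = cong ∣_∣ (added-back z (ℤ.+ 1))
shift-distance minus z = cong ∣_∣ (added-back z -[1+ 0 ])

self-distance : ∀ z → ∣ z ℤ.- z ∣ ≡ 0
self-distance z = cong ∣_∣ (+-inverseʳ z)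

hTip-adjacent : ∀ t → Adjacent (hTip t) (corner t)
hTip-adjacent t = cong₂ _+_ (shift-distance (hdir t) (proj₁ (corner t))) (self-distance (row (corner t)))

vTip-adjacent : ∀ t → Adjacent (vTip t) (corner t)
vTip-adjacent t = cong₂ _+_ (self-distance (proj₁ (corner t))) (shift-distance (vdir t) (row (corner t)))

-- The tips of a tromino, as (black tip , white tip): the horizontal tip
-- shares the corner's row, the vertical tip lies in a row of the other parity.
data TipColouring (t : Tromino) : Cell → Cell → Set where
  hTip-black : Black (corner t) → TipColouring t (hTip t) (vTip t)
  vTip-black : White (corner t) → TipColouring t (vTip t) (hTip t)

colourTips : (t : Tromino) → ∃₂ (TipColouring t)
colourTips t with black? (corner t)
... | yes corner-black = _ , _ , hTip-black corner-black
... | no  corner-white = _ , _ , vTip-black corner-white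

blackTip whiteTip : Tromino → Cell
blackTip t = proj₁ (colourTips t)
whiteTip t = proj₁ (proj₂ (colourTips t))

tipColouring : ∀ t → TipColouring t (blackTip t) (whiteTip t)
tipColouring t = proj₂ (proj₂ (colourTips t))

module _ {t : Tromino} {b w : Cell} where

  black-tip-black : TipColouring t b w → Black b
  black-tip-black (hTip-black corner-black) = corner-black
  black-tip-black (vTip-black corner-white) = proj₂ (vTip-colour t) corner-white

  white-tip-white : TipColouring t b w → White w
  white-tip-white (hTip-black corner-black) = proj₁ (vTip-colour t) corner-black
  white-tip-white (vTip-black corner-white) = corner-white

  tips-in-tromino : TipColouring t b w → b ∈ cells t × w ∈ cells t
  tips-in-tromino (hTip-black _) = there (here refl) , there (there (here refl))
  tips-in-tromino (vTip-black _) = there (there (here refl)) , there (here refl)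

  tromino-roles : TipColouring t b w → ∀ {c} → c ∈ cells t → c ≡ b ⊎ c ≡ corner t ⊎ c ≡ w
  tromino-roles _              (here refl)                 = inj₂ (inj₁ refl)
  tromino-roles (hTip-black _) (there (here refl))         = inj₁ refl
  tromino-roles (vTip-black _) (there (here refl))         = inj₂ (inj₂ refl)
  tromino-roles (hTip-black _) (there (there (here refl))) = inj₂ (inj₂ refl)
  tromino-roles (vTip-black _) (there (there (here refl))) = inj₁ refl

  tips-adjacent : TipColouring t b w → Adjacent b (corner t) × Adjacent (corner t) w
  tips-adjacent (hTip-black _) = hTip-adjacent t , adjacent-sym (vTip t) (corner t) (vTip-adjacent t)
  tips-adjacent (vTip-black _) = vTip-adjacent t , adjacent-sym (hTip t) (corner t) (hTip-adjacent t)

  tips-free : ∀ {P} → hTip t ∉ P → vTip t ∉ P → TipColouring t b w → b ∉ P × w ∉ P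
  tips-free hTip∉P vTip∉P (hTip-black _) = hTip∉P , vTip∉P
  tips-free hTip∉P vTip∉P (vTip-black _) = vTip∉P , hTip∉P

module FlowThroughPegs (R P : List Cell) where
  open Network R P

  BlackFree : Cell → Set
  BlackFree c = c ∉ P × Black c

  blackFree? : (c : Cell) → Dec (BlackFree c)
  blackFree? c = ¬? (c ∈? P) ×-dec black? c

  inflow-split : ∀ f v → inflow f v ≡ f src v + (f snk v + (∑[ c ∈ R ] f (cell c) v))
  inflow-split f v = cong (λ z → f src v + (f snk v + z)) (∑-map cell R (λ u → f u v))

  outflow-split : ∀ f v → outflow f v ≡ f v src + (f v snk + (∑[ c ∈ R ] f v (cell c)))
  outflow-split f v = cong (λ z → f v src + (f v snk + z)) (∑-map cell R (f v))

  without-terminals : ∀ {a b n} → a ≡ 0 → b ≡ 0 → a + (b + n) ≡ n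
  without-terminals refl refl = refl

  module _ {f : Vertex → Vertex → ℕ} (isFlow : IsFlow f) where
    open IsFlow isFlow

    source-feeds-B : ∀ c → f src (cell c) ≡ ⟦ blackFree? c ⟧ * inflow f (cell c)
    source-feeds-B c with blackFree? c
    ... | no c∉B = offEdges _ _ λ { (s→b (_ , c∉P , black)) → c∉B (c∉P , black) }
    ... | yes (c∉P , black) = sym (begin
      1 * inflow f (cell c)
        ≡⟨ trans (*-identityˡ _) (inflow-split f (cell c)) ⟩
      f src (cell c) + (f snk (cell c) + (∑[ c' ∈ R ] f (cell c') (cell c)))
        ≡⟨ cong (f src (cell c) +_) (cong₂ _+_ (offEdges _ _ λ ()) (∑-zero R λ _ → offEdges _ _ no-cell-feeds-c)) ⟩
      f src (cell c) + 0
        ≡⟨ Nat.+-identityʳ _ ⟩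
      f src (cell c) ∎)
      where
      no-cell-feeds-c : ∀ {c'} → ¬ Edge (cell c') (cell c)
      no-cell-feeds-c (b→p _ c∈P _)           = c∉P c∈P
      no-cell-feeds-c (p→w _ (_ , _ , white) _) = white black

    B-sends-to-pegs : ∀ c → ⟦ blackFree? c ⟧ * outflow f (cell c)
                    ≡ ∑[ c' ∈ R ] ⟦ blackFree? c ⟧ * (⟦ c' ∈? P ⟧ * f (cell c) (cell c'))
    B-sends-to-pegs c with blackFree? c
    ... | no _ = sym (∑-zero R λ _ → refl)
    ... | yes (c∉P , black) = begin
      1 * outflow f (cell c)
        ≡⟨ trans (*-identityˡ _) (outflow-split f (cell c)) ⟩
      f (cell c) src + (f (cell c) snk + (∑[ c' ∈ R ] f (cell c) (cell c')))
        ≡⟨ without-terminals (offEdges _ _ λ ()) (offEdges _ _ λ { (w→t (_ , _ , white)) → white black }) ⟩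
      ∑[ c' ∈ R ] f (cell c) (cell c')
        ≡⟨ ∑-cong R (λ {c'} _ → only-to-pegs c') ⟩
      ∑[ c' ∈ R ] 1 * (⟦ c' ∈? P ⟧ * f (cell c) (cell c')) ∎
      where
      only-to-pegs : ∀ c' → f (cell c) (cell c') ≡ 1 * (⟦ c' ∈? P ⟧ * f (cell c) (cell c'))
      only-to-pegs c' with c' ∈? P
      ... | yes _    = sym (trans (*-identityˡ _) (*-identityˡ _))
      ... | no c'∉P = offEdges _ _ λ { (b→p _ c'∈P _) → c'∉P c'∈P ; (p→w c∈P _ _) → c∉P c∈P }

    pegs-receive-from-B : ∀ c' → ∑[ c ∈ R ] ⟦ blackFree? c ⟧ * (⟦ c' ∈? P ⟧ * f (cell c) (cell c'))
                        ≡ ⟦ c' ∈? P ⟧ * inflow f (cell c')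
    pegs-receive-from-B c' with c' ∈? P
    ... | no _ = ∑-zero R (λ {c} _ → *-zeroʳ ⟦ blackFree? c ⟧)
    ... | yes c'∈P = sym (begin
      1 * inflow f (cell c')
        ≡⟨ trans (*-identityˡ _) (inflow-split f (cell c')) ⟩
      f src (cell c') + (f snk (cell c') + (∑[ c ∈ R ] f (cell c) (cell c')))
        ≡⟨ without-terminals (offEdges _ _ λ { (s→b (_ , c'∉P , _)) → c'∉P c'∈P }) (offEdges _ _ λ ()) ⟩
      ∑[ c ∈ R ] f (cell c) (cell c')
        ≡⟨ ∑-cong R (λ {c} _ → only-from-B c) ⟩
      ∑[ c ∈ R ] ⟦ blackFree? c ⟧ * (1 * f (cell c) (cell c')) ∎)
      where
      only-from-B : ∀ c → f (cell c) (cell c') ≡ ⟦ blackFree? c ⟧ * (1 * f (cell c) (cell c'))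
      only-from-B c with blackFree? c
      ... | yes _   = sym (trans (*-identityˡ _) (*-identityˡ _))
      ... | no c∉B = offEdges _ _ λ { (b→p (_ , c∉P , black) _ _) → c∉B (c∉P , black)
                                     ; (p→w _ (_ , c'∉P , _) _)     → c'∉P c'∈P }

    value-through-pegs : value f ≡ ∑[ c ∈ R ] ⟦ c ∈? P ⟧ * inflow f (cell c)
    value-through-pegs = begin
      value f
        ≡⟨ trans (outflow-split f src) (without-terminals (offEdges _ _ λ ()) (offEdges _ _ λ ())) ⟩
      ∑[ c ∈ R ] f src (cell c)
        ≡⟨ ∑-cong R (λ {c} _ → source-feeds-B c) ⟩
      ∑[ c ∈ R ] ⟦ blackFree? c ⟧ * inflow f (cell c)
        ≡⟨ ∑-cong R (λ {c} c∈R → cong (⟦ blackFree? c ⟧ *_) (conservation c∈R)) ⟩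
      ∑[ c ∈ R ] ⟦ blackFree? c ⟧ * outflow f (cell c)
        ≡⟨ ∑-cong R (λ {c} _ → B-sends-to-pegs c) ⟩
      ∑[ c ∈ R ] ∑[ c' ∈ R ] ⟦ blackFree? c ⟧ * (⟦ c' ∈? P ⟧ * f (cell c) (cell c'))
        ≡⟨ ∑-swap R R _ ⟩
      ∑[ c' ∈ R ] ∑[ c ∈ R ] ⟦ blackFree? c ⟧ * (⟦ c' ∈? P ⟧ * f (cell c) (cell c'))
        ≡⟨ ∑-cong R (λ {c'} _ → pegs-receive-from-B c') ⟩
      ∑[ c' ∈ R ] ⟦ c' ∈? P ⟧ * inflow f (cell c') ∎

    value≤pegs : value f ≤ ∑[ c ∈ R ] ⟦ c ∈? P ⟧
    value≤pegs = ≤-trans (≤-reflexive value-through-pegs)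
                         (∑-mono R λ {c} c∈R → ≤-trans (Nat.*-monoʳ-≤ ⟦ c ∈? P ⟧ (vertexCap c∈R))
                                                       (≤-reflexive (*-identityʳ _)))

pathEdges : {A : Set} → List A → List (A × A)
pathEdges []           = []
pathEdges (x ∷ [])     = []
pathEdges (x ∷ y ∷ xs) = (x , y) ∷ pathEdges (y ∷ xs)

module _ {A : Set} where

  source-on-path : ∀ {xs} {u v : A} → (u , v) ∈ pathEdges xs → u ∈ xs
  source-on-path {x ∷ y ∷ xs} (here refl) = here refl
  source-on-path {x ∷ y ∷ xs} (there e)   = there (source-on-path e)

  target-on-path : ∀ {x xs} {u v : A} → (u , v) ∈ pathEdges (x ∷ xs) → v ∈ xs
  target-on-path {xs = y ∷ xs} (here refl) = here refl
  target-on-path {xs = y ∷ xs} (there e)   = there (target-on-path e)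

  predecessor-unique : ∀ {xs} {u u' v : A} → Unique xs
                     → (u , v) ∈ pathEdges xs → (u' , v) ∈ pathEdges xs → u ≡ u'
  predecessor-unique {x ∷ y ∷ xs} _              (here refl) (here refl) = refl
  predecessor-unique {x ∷ y ∷ xs} (_ ∷ y∉xs ∷ _) (here refl) (there e')  =
    ⊥-elim (All.lookup y∉xs (target-on-path e') refl)
  predecessor-unique {x ∷ y ∷ xs} (_ ∷ y∉xs ∷ _) (there e)   (here refl) =
    ⊥-elim (All.lookup y∉xs (target-on-path e) refl)
  predecessor-unique {x ∷ y ∷ xs} (_ ∷ unique)   (there e)   (there e')  =
    predecessor-unique unique e e'

  successor-unique : ∀ {xs} {u v v' : A} → Unique xs
                   → (u , v) ∈ pathEdges xs → (u , v') ∈ pathEdges xs → v ≡ v'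
  successor-unique {x ∷ y ∷ xs} _          (here refl) (here refl) = refl
  successor-unique {x ∷ y ∷ xs} (x∉ ∷ _)   (here refl) (there e')  =
    ⊥-elim (All.lookup x∉ (source-on-path e') refl)
  successor-unique {x ∷ y ∷ xs} (x∉ ∷ _)   (there e)   (here refl) =
    ⊥-elim (All.lookup x∉ (source-on-path e) refl)
  successor-unique {x ∷ y ∷ xs} (_ ∷ unique) (there e) (there e')  =
    successor-unique unique e e'

disjoint-unique : ∀ {T t t' c} → AllPairs DisjointT T → t ∈ T → t' ∈ T
                → c ∈ cells t → c ∈ cells t' → t ≡ t'
disjoint-unique _           (here refl) (here refl) _   _    = refl
disjoint-unique (t∩ ∷ _)    (here refl) (there t'∈) c∈t c∈t' = ⊥-elim (All.lookup t∩ t'∈ c∈t c∈t')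
disjoint-unique (t'∩ ∷ _)   (there t∈)  (here refl) c∈t c∈t' = ⊥-elim (All.lookup t'∩ t∈ c∈t' c∈t)
disjoint-unique (_ ∷ disj)  (there t∈)  (there t'∈) c∈t c∈t' = disjoint-unique disj t∈ t'∈ c∈t c∈t'

cell-injective : ∀ {a b} → cell a ≡ cell b → a ≡ b
cell-injective refl = refl

_≟V_ : DecidableEquality Vertex
src    ≟V src    = yes refl
snk    ≟V snk    = yes refl
cell a ≟V cell b with a ≟C b
... | yes refl = yes refl
... | no  a≢b  = no (a≢b ∘ cell-injective)
src    ≟V snk    = no λ ()
src    ≟V cell _ = no λ ()
snk    ≟V src    = no λ ()
snk    ≟V cell _ = no λ ()
cell _ ≟V src    = no λ ()
cell _ ≟V snk    = no λ ()

vertices-unique : ∀ {R} P → Unique R → Unique (Network.vertices R P)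
vertices-unique {R} P uR =
  ((λ ()) All.∷ All-map⁺ (All.universal (λ _ ()) R)) ∷
  All-map⁺ (All.universal (λ _ ()) R) ∷
  Unique-map⁺ cell-injective uR

module CoverFlow (R P : List Cell) (uR : Unique R) (T : List Tromino) (cover : PCover R P T) where
  open Network R P
  open PCover cover
  open DecMembership (≡-dec _≟V_ _≟V_) using () renaming (_∈?_ to _∈ₑ?_)

  route : Tromino → List Vertex
  route t = src ∷ cell (blackTip t) ∷ cell (corner t) ∷ cell (whiteTip t) ∷ snk ∷ []

  flow : Vertex → Vertex → ℕ
  flow u v = ⟦ any? (λ t → (u , v) ∈ₑ? pathEdges (route t)) T ⟧

  flow-on-route : ∀ {t u v} → t ∈ T → (u , v) ∈ pathEdges (route t) → flow u v ≡ 1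
  flow-on-route t∈T e = ⟦⟧-yes _ (lose t∈T e)

  flow-off-routes : ∀ {u v} → (∀ {t} → t ∈ T → (u , v) ∉ pathEdges (route t)) → flow u v ≡ 0
  flow-off-routes off = ⟦⟧-no _ λ on → let _ , t∈T , e = find on in off t∈T e

  module _ {t : Tromino} (t∈T : t ∈ T) where

    in-region : ∀ {c} → c ∈ cells t → c ∈ R
    in-region = All.lookup (All.lookup contained t∈T)

    corner-peg : corner t ∈ P
    corner-peg = All.lookup cornerPeg t∈T

    tips∉P : blackTip t ∉ P × whiteTip t ∉ P
    tips∉P = tips-free (All.lookup hTipFree t∈T) (All.lookup vTipFree t∈T) (tipColouring t)

    blackTip∈B : InB (blackTip t)
    blackTip∈B = in-region (proj₁ (tips-in-tromino (tipColouring t))) , proj₁ tips∉P ,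
                 black-tip-black (tipColouring t)

    whiteTip∈W : InW (whiteTip t)
    whiteTip∈W = in-region (proj₂ (tips-in-tromino (tipColouring t))) , proj₂ tips∉P ,
                 white-tip-white (tipColouring t)

    route-unique : Unique (route t)
    route-unique = ((λ ()) All.∷ (λ ()) All.∷ (λ ()) All.∷ (λ ()) All.∷ All.[])
                 ∷ (black≢peg All.∷ black≢white All.∷ (λ ()) All.∷ All.[])
                 ∷ (peg≢white All.∷ (λ ()) All.∷ All.[])
                 ∷ ((λ ()) All.∷ All.[])
                 ∷ All.[] ∷ []
      where
      black≢peg : cell (blackTip t) ≢ cell (corner t)
      black≢peg eq = proj₁ tips∉P (subst (_∈ P) (sym (cell-injective eq)) corner-peg)
      black≢white : cell (blackTip t) ≢ cell (whiteTip t)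
      black≢white eq = white-tip-white (tipColouring t) (subst Black (cell-injective eq) (black-tip-black (tipColouring t)))
      peg≢white : cell (corner t) ≢ cell (whiteTip t)
      peg≢white eq = proj₂ tips∉P (subst (_∈ P) (cell-injective eq) corner-peg)

    route-in-network : ∀ {u v} → (u , v) ∈ pathEdges (route t) → Edge u v
    route-in-network (here refl)                         = s→b blackTip∈B
    route-in-network (there (here refl))                 =
      b→p blackTip∈B corner-peg (proj₁ (tips-adjacent (tipColouring t)))
    route-in-network (there (there (here refl)))         =
      p→w corner-peg whiteTip∈W (proj₂ (tips-adjacent (tipColouring t)))
    route-in-network (there (there (there (here refl)))) = w→t whiteTip∈W
    route-in-network (there (there (there (there ()))))

    route-cells : ∀ {c} → cell c ∈ route t → c ∈ cells t
    route-cells (there (here refl))                 = proj₁ (tips-in-tromino (tipColouring t))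
    route-cells (there (there (here refl)))         = here refl
    route-cells (there (there (there (here refl)))) = proj₂ (tips-in-tromino (tipColouring t))
    route-cells (there (there (there (there (there ())))))

    route-in-vertices : ∀ {u} → u ∈ route t → u ∈ vertices
    route-in-vertices {src}    _   = here refl
    route-in-vertices {snk}    _   = there (here refl)
    route-in-vertices {cell c} u∈ = there (there (∈-map⁺ cell (in-region (route-cells u∈))))

    passes-through : ∀ {c} → c ∈ cells t
                   → (∃[ u ] (u , cell c) ∈ pathEdges (route t)) × (∃[ v ] (cell c , v) ∈ pathEdges (route t))
    passes-through c∈t with tromino-roles (tipColouring t) c∈t
    ... | inj₁ refl        = (_ , here refl) , (_ , there (here refl))
    ... | inj₂ (inj₁ refl) = (_ , there (here refl)) , (_ , there (there (here refl)))
    ... | inj₂ (inj₂ refl) = (_ , there (there (here refl))) , (_ , there (there (there (here refl))))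

  only-route : ∀ {t t' c} → t ∈ T → t' ∈ T → c ∈ cells t → cell c ∈ route t' → t' ≡ t
  only-route t∈T t'∈T c∈t on-route = disjoint-unique nonOverlapping t'∈T t∈T (route-cells t'∈T on-route) c∈t

  inflow-one : ∀ {c} → c ∈ R → inflow flow (cell c) ≡ 1
  inflow-one {c} c∈R with covers c∈R
  ... | t , t∈T , c∈t with proj₁ (passes-through t∈T c∈t)
  ... | u₀ , e₀ = begin
    inflow flow (cell c)
      ≡⟨ ∑-single vertices (vertices-unique P uR) (route-in-vertices t∈T (source-on-path e₀)) others ⟩
    flow u₀ (cell c)
      ≡⟨ flow-on-route t∈T e₀ ⟩
    1 ∎
    where
    others : ∀ {u} → u ∈ vertices → u ≢ u₀ → flow u (cell c) ≡ 0
    others {u} _ u≢u₀ = flow-off-routes into-c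
      where
      into-c : ∀ {t'} → t' ∈ T → (u , cell c) ∉ pathEdges (route t')
      into-c t'∈T e with only-route t∈T t'∈T c∈t (there (target-on-path e))
      ... | refl = u≢u₀ (predecessor-unique (route-unique t∈T) e e₀)

  outflow-one : ∀ {c} → c ∈ R → outflow flow (cell c) ≡ 1
  outflow-one {c} c∈R with covers c∈R
  ... | t , t∈T , c∈t with proj₂ (passes-through t∈T c∈t)
  ... | v₀ , e₀ = begin
    outflow flow (cell c)
      ≡⟨ ∑-single vertices (vertices-unique P uR) (route-in-vertices t∈T (there (target-on-path e₀))) others ⟩
    flow (cell c) v₀
      ≡⟨ flow-on-route t∈T e₀ ⟩
    1 ∎
    where
    others : ∀ {v} → v ∈ vertices → v ≢ v₀ → flow (cell c) v ≡ 0
    others {v} _ v≢v₀ = flow-off-routes out-of-c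
      where
      out-of-c : ∀ {t'} → t' ∈ T → (cell c , v) ∉ pathEdges (route t')
      out-of-c t'∈T e with only-route t∈T t'∈T c∈t (source-on-path e)
      ... | refl = v≢v₀ (successor-unique (route-unique t∈T) e e₀)

  isFlow : IsFlow flow
  isFlow = record
    { offEdges     = λ u v not-edge → flow-off-routes λ t∈T e → not-edge (route-in-network t∈T e)
    ; edgeCap      = λ u v → ⟦⟧≤1 _
    ; vertexCap    = λ c∈R → ≤-reflexive (inflow-one c∈R)
    ; conservation = λ c∈R → trans (inflow-one c∈R) (sym (outflow-one c∈R))
    }

lemma3p4 : (R P : List Cell) → IsRegion R → Unique P → All (_∈ R) P
         → (k : ℕ) → length R ≡ 3 * k → length P ≡ k
         → HasPCover R P → Network.MaxFlowValue R P k
lemma3p4 R P region uP P⊆R k _ |P|≡k (T , cover) = (flow , isFlow , value-is-k) , bounded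
  where
  open Network R P using (IsFlow; value; inflow)
  open FlowThroughPegs R P using (value-through-pegs; value≤pegs)
  uR : Unique R
  uR = IsRegion.distinct region
  open CoverFlow R P uR T cover using (flow; isFlow; inflow-one)

  pegs-count : ∑[ c ∈ R ] ⟦ c ∈? P ⟧ ≡ k
  pegs-count = trans (count-members P uR uP P⊆R) |P|≡k

  value-is-k : value flow ≡ k
  value-is-k = begin
    value flow                                   ≡⟨ value-through-pegs isFlow ⟩
    ∑[ c ∈ R ] ⟦ c ∈? P ⟧ * inflow flow (cell c) ≡⟨ ∑-cong R (λ {c} c∈R → trans (cong (⟦ c ∈? P ⟧ *_) (inflow-one c∈R))
                                                                                 (*-identityʳ _)) ⟩
    ∑[ c ∈ R ] ⟦ c ∈? P ⟧                        ≡⟨ pegs-count ⟩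
    k                                            ∎

  bounded : ∀ g → IsFlow g → value g ≤ k
  bounded g isFlow-g = ≤-trans (value≤pegs isFlow-g) (≤-reflexive pegs-count)
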